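{- Let $P$ be a valid PBP of $T$ with following position $i$, let $j\in\{1,\dots,n\}$ and $\ell\ge1$ be such that $P\cdot\langle j,\ell\rangle$ is a valid PBP. (1) For every $x\in\{i,\dots,i+\ell-1\}$ there is a set $X\in\mathcal{D}'_{P\cdot\langle j,\ell\rangle}$ containing both $x$ and $\mathit{source}(P\cdot\langle j,\ell\rangle,x)$. (2) If moreover $P\cdot\langle j,\ell+1\rangle$ is a valid PBP, then $\mathcal{D}'_{P\cdot\langle j,\ell+1\rangle}$ can be obtained from $\mathcal{D}'_{P\cdot\langle j,\ell\rangle}$ by performing $O(1)$ $\mathit{Union}$ and $\mathit{MakeSet}'$ operations.
   Context: Let $T=T[1]\cdots T[n]$ be a string over an ordered alphabet $\Sigma$ (elements regarded as distinct from integers). A partial bidirectional parse (PBP) of $T$ is a sequence of phrases $f_1,\dots,f_k$ partitioning a prefix $T[1..m]$, with $f_x=T[s_x..s_x+|f_x|-1]$, $s_1=1$, $s_{x+1}=s_x+|f_x|$; each phrase is a character phrase ($|f_x|=1$, storing $T[s_x]$) or a target phrase $\langle t_x,|f_x|\rangle$ with $t_x\in\{1,\dots,n\}$, $t_x\ne s_x$, $t_x+|f_x|-1\le n$, $T[t_x..t_x+|f_x|-1]=T[s_x..s_x+|f_x|-1]$. The position following $P$ is $i=m+1$. $B_P$ is $P$ followed by character phrases $T[m+1],\dots,T[n]$. For $B_P$ define $g^0(x)=T[x]$ if $x$ lies in a character phrase and $g^0(x)=t_p+(x-s_p)$ if $x$ lies in target phrase $f_p$; $g^k(x)=g^{k-1}(x)$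 if $g^{k-1}(x)\in\Sigma$, else $g^k(x)=g^0(g^{k-1}(x))$. $P$ is valid if $g^n(x)\in\Sigma$ for all $x$. $P\cdot\langle j,\ell\rangle$ appends the target phrase $\langle j,\ell\rangle$ covering $T[i..i+\ell-1]$. For a valid PBP $Q$ and position $x$, $\mathit{source}(Q,x)$ is the position $y$ with either $g^0(x)\in\Sigma$ and $y=x$, or $g^k(x)=y$ and $g^{k+1}(x)\in\Sigma$ for some $k\ge0$ (computed in $B_Q$). For $Q=P\cdot\langle j,\ell\rangle$ valid, $U(Q)=\{i,\dots,i+\ell-1\}\cup\{\mathit{source}(Q,x):x\in\{i,\dots,i+\ell-1\}\}$, and $\mathcal{D}'_Q$ is the partition of $U(Q)$ into classes of positions having the same source in $Q$. $\mathit{Union}$ merges two sets of a disjoint-set family; $\mathit{MakeSet}'(x)$ adds the singleton $\{x\}$ to the family if $x$ is not already an element. -}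

module Defs where

open import Level using (Level; 0ℓ) renaming (suc to lsuc)
open import Data.Nat using (ℕ; zero; suc; _+_; _∸_; _≤_; _<_; _≟_; _<?_; _≤?_)
open import Data.List using (List; []; _∷_; _++_; [_])
open import Data.Sum using (_⊎_; inj₁; inj₂)
open import Data.Product using (Σ; ∃; _×_; _,_; ∃-syntax)
open import Data.Bool using (Bool; true; false; if_then_else_; _∧_)
open import Data.Unit using (⊤)
open import Data.Empty using (⊥)
open import Relation.Nullary using (¬_; does)
open import Relation.Binary.PropositionalEquality using (_≡_)
open import Function.Bundles using (_⇔_)

-- Phrases and partial bidirectional parses (positions are 1-based ℕ)

-- A character phrase has length 1 and stores T[s]; since the stored
-- character is determined by its position we do not record it.
data Phrase : Set where
  chr : Phrase
  tgt : (t len : ℕ) → Phrase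

PBP : Set
PBP = List Phrase

phraseLen : Phrase → ℕ
phraseLen chr       = 1
phraseLen (tgt t ℓ) = ℓ

covered : PBP → ℕ
covered []      = 0
covered (f ∷ P) = phraseLen f + covered P

next : PBP → ℕ
next P = suc (covered P)

_·⟨_,_⟩ : PBP → ℕ → ℕ → PBP
P ·⟨ j , ℓ ⟩ = P ++ [ tgt j ℓ ]

InNew : PBP → ℕ → ℕ → Set
InNew P ℓ x = next P ≤ x × x < next P + ℓ

IsChar : {A : Set} → A ⊎ ℕ → Set
IsChar (inj₁ _) = ⊤
IsChar (inj₂ _) = ⊥

-- Everything depending on the text T = T[1] ⋯ T[n] over alphabet A.
-- T is given as a function ℕ → A of which only T 1 … T n are used.

module _ {A : Set} (n : ℕ) (T : ℕ → A) where

  PhrasesOK : ℕ → PBP → Set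
  PhrasesOK s []            = ⊤
  PhrasesOK s (chr ∷ P)     = PhrasesOK (suc s) P
  PhrasesOK s (tgt t ℓ ∷ P) =
    (1 ≤ ℓ × 1 ≤ t × t ≤ n × ¬ (t ≡ s) × t + ℓ ∸ 1 ≤ n
      × (∀ k → k < ℓ → T (t + k) ≡ T (s + k)))
    × PhrasesOK (s + ℓ) P

  IsPBP : PBP → Set
  IsPBP P = covered P ≤ n × PhrasesOK 1 P

  -- g⁰ in B_P (positions beyond the prefix are character phrases)
  g0' : ℕ → PBP → ℕ → A ⊎ ℕ
  g0' s []            x = inj₁ (T x)
  g0' s (chr ∷ P)     x = if does (x ≟ s) then inj₁ (T x) else g0' (suc s) P x
  g0' s (tgt t ℓ ∷ P) x =
    if does (s ≤? x) ∧ does (x <? s + ℓ) then inj₂ (t + (x ∸ s)) else g0' (s + ℓ) P x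

  g0 : PBP → ℕ → A ⊎ ℕ
  g0 P = g0' 1 P

  gstep : PBP → A ⊎ ℕ → A ⊎ ℕ
  gstep P (inj₁ c) = inj₁ c
  gstep P (inj₂ y) = g0 P y

  g : PBP → ℕ → ℕ → A ⊎ ℕ
  g P zero    x = g0 P x
  g P (suc k) x = gstep P (g P k x)

  Valid : PBP → Set
  Valid P = IsPBP P × (∀ x → 1 ≤ x → x ≤ n → IsChar (g P n x))

  Source : PBP → ℕ → ℕ → Set
  Source Q x y =
    (IsChar (g0 Q x) × y ≡ x)
    ⊎ (∃[ k ] (g Q k x ≡ inj₂ y × IsChar (g Q (suc k) x)))

  InU : PBP → ℕ → ℕ → ℕ → Set
  InU P j ℓ x =
    InNew P ℓ x ⊎ (∃[ x' ] (InNew P ℓ x' × Source (P ·⟨ j , ℓ ⟩) x' x))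

-- Disjoint-set families, represented by their ground set and the
-- relation "lie in the same set".

record Family : Set₁ where
  field
    Dom  : ℕ → Set
    Same : ℕ → ℕ → Set
open Family public

_∈F_ : (ℕ → Set) → Family → Set
X ∈F F = ∃[ z ] (Dom F z × (∀ w → (X w ⇔ Same F z w)))

_≈F_ : Family → Family → Set
F ≈F G = (∀ x → Dom F x ⇔ Dom G x) × (∀ x y → Same F x y ⇔ Same G x y)

D' : {A : Set} (n : ℕ) (T : ℕ → A) → PBP → ℕ → ℕ → Family
D' n T P j ℓ = record
  { Dom  = InU n T P j ℓ
  ; Same = λ x y → InU n T P j ℓ x × InU n T P j ℓ y
                   × ∃[ s ] (Source n T (P ·⟨ j , ℓ ⟩) x s × Source n T (P ·⟨ j , ℓ ⟩) y s)
  }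

data Op : Set where
  makeSet' : ℕ → Op
  union    : ℕ → ℕ → Op

applyOp : Op → Family → Family
applyOp (makeSet' x) F = record
  { Dom  = λ w → Dom F w ⊎ w ≡ x
  ; Same = λ u v → Same F u v ⊎ (u ≡ x × v ≡ x)
  }
applyOp (union a b) F = record
  { Dom  = Dom F
  ; Same = λ u v → Same F u v ⊎ (Same F u a × Same F b v) ⊎ (Same F u b × Same F a v)
  }

Applicable : Family → List Op → Set
Applicable F []                  = ⊤
Applicable F (makeSet' x ∷ os)   = Applicable (applyOp (makeSet' x) F) os
Applicable F (union a b ∷ os)    = (Dom F a × Dom F b) × Applicable (applyOp (union a b) F) os

run : Family → List Op → Family
run F []       = F
run F (o ∷ os) = run (applyOp o F) os

module Submission where

open import Defs
open import Data.Nat using (ℕ; zero; suc; _+_; _≤_; _<_; _≟_; _<?_; _≤?_; z≤n; s≤s)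
open import Data.Nat.Properties
open import Data.List using (List; length; []; _∷_; _++_; [_])
open import Data.Product using (_×_; ∃-syntax; _,_; proj₁; proj₂)
open import Data.Sum using (_⊎_; inj₁; inj₂)
open import Data.Unit using (tt)
open import Data.Empty using (⊥-elim)
open import Data.Bool using (true; false; _∧_)
open import Data.Bool.Properties using (∧-zeroʳ)
open import Function using (_∘_; id)
open import Function.Bundles using (mk⇔)
open import Relation.Nullary using (¬_; yes; no; does; contradiction)
open import Relation.Nullary.Decidable using (dec-true; dec-false)
open import Relation.Binary.PropositionalEquality
  using (_≡_; _≢_; refl; sym; trans; cong; subst)

-- Following the pointers of g⁰ from x to a character position is the same as
-- computing source(Q, x).  Extending the last phrase ⟨j,ℓ⟩ to ⟨j,ℓ+1⟩ changes g⁰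
-- only at p = i + ℓ, which was a character position and now points elsewhere; so
-- the positions whose source was p now have the source s' of p in the longer
-- parse, while all other sources are unchanged.  Hence 𝒟' is updated by making
-- the (possibly new) singletons {p} and {s'} and uniting the classes of p and s'.

data Path {A : Set} (G : ℕ → A ⊎ ℕ) : ℕ → ℕ → Set where
  stop : ∀ {x} → IsChar (G x) → Path G x x
  step : ∀ {x z y} → G x ≡ inj₂ z → Path G z y → Path G x y

module _ {A : Set} {G : ℕ → A ⊎ ℕ} where

  IsChar⇒¬ptr : ∀ {x z} → IsChar (G x) → G x ≢ inj₂ z
  IsChar⇒¬ptr c e = subst IsChar e c

  Path-end : ∀ {x y} → Path G x y → IsChar (G y)
  Path-end (stop c)   = c
  Path-end (step _ q) = Path-end q

  Path-unique : ∀ {x y y′} → Path G x y → Path G x y′ → y ≡ y′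
  Path-unique (stop _)   (stop _)    = refl
  Path-unique (stop c)   (step e _)  = ⊥-elim (IsChar⇒¬ptr c e)
  Path-unique (step e _) (stop c)    = ⊥-elim (IsChar⇒¬ptr c e)
  Path-unique (step e q) (step e′ q′) with trans (sym e) e′
  ... | refl = Path-unique q q′

module Redirect {A : Set} (G G′ : ℕ → A ⊎ ℕ) (p : ℕ)
  (agree : ∀ x → x ≢ p → G x ≡ G′ x) (G-p : IsChar (G p)) (G′-p : ¬ IsChar (G′ p)) where

  ptr⇒≢p : ∀ {x z} → G x ≡ inj₂ z → x ≢ p
  ptr⇒≢p e refl = IsChar⇒¬ptr {G = G} G-p e

  Path-avoiding : ∀ {x y} → Path G x y → y ≢ p → Path G′ x y
  Path-avoiding {x} (stop c)   y≢p = stop (subst IsChar (agree x y≢p) c)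
  Path-avoiding {x} (step e q) y≢p = step (trans (sym (agree x (ptr⇒≢p e))) e) (Path-avoiding q y≢p)

  Path-via : ∀ {x s} → Path G x p → Path G′ p s → Path G′ x s
  Path-via (stop _)       r = r
  Path-via {x} (step e q) r = step (trans (sym (agree x (ptr⇒≢p e))) e) (Path-via q r)

  Path-split : ∀ {x s} → Path G′ x s → (Path G x s × s ≢ p) ⊎ (Path G x p × Path G′ p s)
  Path-split {x} (stop c) = inj₁ (stop (subst IsChar (sym (agree x x≢p)) c) , x≢p)
    where
      x≢p : x ≢ p
      x≢p refl = G′-p c
  Path-split {x} (step e q) with x ≟ p
  ... | yes refl = inj₂ (stop G-p , step e q)
  ... | no x≢p with Path-split q
  ...   | inj₁ (q₁ , s≢p) = inj₁ (step (trans (agree x x≢p) e) q₁ , s≢p)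
  ...   | inj₂ (q₁ , r)   = inj₂ (step (trans (agree x x≢p) e) q₁ , r)

module SourcePaths {A : Set} (n : ℕ) (T : ℕ → A) (Q : PBP) where

  g-suc-ptr : ∀ {x z} k → g0 n T Q x ≡ inj₂ z → g n T Q (suc k) x ≡ g n T Q k z
  g-suc-ptr zero    e rewrite e = refl
  g-suc-ptr (suc k) e rewrite g-suc-ptr k e = refl

  g-char : ∀ {x c} k → g0 n T Q x ≡ inj₁ c → g n T Q k x ≡ inj₁ c
  g-char zero    e = e
  g-char (suc k) e rewrite g-char k e = refl

  ptr-then-char⇒Path : ∀ {y} k x → g n T Q k x ≡ inj₂ y → IsChar (g n T Q (suc k) x)
                     → Path (g0 n T Q) x y
  ptr-then-char⇒Path zero x e c = step e (stop (subst (IsChar ∘ gstep n T Q) e c))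
  ptr-then-char⇒Path (suc k) x e c with g0 n T Q x in eq
  ... | inj₁ _ with () ← trans (sym (g-char (suc k) eq)) e
  ... | inj₂ z = step eq (ptr-then-char⇒Path k z (trans (sym (g-suc-ptr k eq)) e)
                                                 (subst IsChar (g-suc-ptr (suc k) eq) c))

  Source⇒Path : ∀ {x y} → Source n T Q x y → Path (g0 n T Q) x y
  Source⇒Path (inj₁ (c , refl))      = stop c
  Source⇒Path {x} (inj₂ (k , e , c)) = ptr-then-char⇒Path k x e c

  Path⇒Source : ∀ {x y} → Path (g0 n T Q) x y → Source n T Q x y
  Path⇒Source (stop c) = inj₁ (c , refl)
  Path⇒Source (step e q) with Path⇒Source q
  ... | inj₁ (c , refl)   = inj₂ (0 , e , subst (IsChar ∘ gstep n T Q) (sym e) c)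
  ... | inj₂ (k , e′ , c) = inj₂ (suc k , trans (g-suc-ptr k e) e′ , subst IsChar (sym (g-suc-ptr (suc k) e)) c)

  IsChar-g⇒∃Path : ∀ k x → IsChar (g n T Q k x) → ∃[ y ] Path (g0 n T Q) x y
  IsChar-g⇒∃Path zero x c = x , stop c
  IsChar-g⇒∃Path (suc k) x c with g0 n T Q x in eq
  ... | inj₁ _ = x , stop (subst IsChar (sym eq) tt)
  ... | inj₂ z with IsChar-g⇒∃Path k z (subst IsChar (g-suc-ptr k eq) c)
  ...   | y , q = y , step eq q

  Source-unique : ∀ {x y y′} → Source n T Q x y → Source n T Q x y′ → y ≡ y′
  Source-unique a b = Path-unique (Source⇒Path a) (Source⇒Path b)

  Source-self : ∀ {x y} → Source n T Q x y → Source n T Q y y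
  Source-self a = Path⇒Source (stop (Path-end (Source⇒Path a)))

covered-++ : ∀ P f → covered (P ++ [ f ]) ≡ covered P + phraseLen f
covered-++ []       f = +-identityʳ (phraseLen f)
covered-++ (f′ ∷ P) f rewrite covered-++ P f = sym (+-assoc (phraseLen f′) (covered P) (phraseLen f))

m<n+suc[o]∧m≢n+o⇒m<n+o : ∀ {m} n o → m ≢ n + o → m < n + suc o → m < n + o
m<n+suc[o]∧m≢n+o⇒m<n+o {m} n o m≢n+o m<n+1+o = ≤∧≢⇒< (≤-pred (subst (m <_) (+-suc n o) m<n+1+o)) m≢n+o

module _ {A : Set} (n : ℕ) (T : ℕ → A) where

  g0'-++-beyond : ∀ s P R x → s + covered P ≤ x → g0' n T s (P ++ R) x ≡ g0' n T (s + covered P) R x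
  g0'-++-beyond s [] R x h rewrite +-identityʳ s = refl
  g0'-++-beyond s (chr ∷ P) R x h with x ≟ s
  ... | yes refl = contradiction h (<⇒≱ (m<m+n s (s≤s z≤n)))
  ... | no x≢s rewrite dec-false (x ≟ s) x≢s | +-suc s (covered P) = g0'-++-beyond (suc s) P R x h
  g0'-++-beyond s (tgt t m ∷ P) R x h with x <? s + m
  ... | yes x<s+m = contradiction h (<⇒≱ (<-≤-trans x<s+m (≤-trans (m≤m+n (s + m) (covered P))
                                                                   (≤-reflexive (+-assoc s m (covered P))))))
  ... | no x≮s+m rewrite dec-false (x <? s + m) x≮s+m | ∧-zeroʳ (does (s ≤? x)) | sym (+-assoc s m (covered P))
    = g0'-++-beyond (s + m) P R x h

  module _ (j ℓ : ℕ) where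

    g0'-tgt-extend : ∀ c x → x ≢ c + ℓ → g0' n T c [ tgt j ℓ ] x ≡ g0' n T c [ tgt j (suc ℓ) ] x
    g0'-tgt-extend c x x≢c+ℓ with c ≤? x
    ... | no c≰x rewrite dec-false (c ≤? x) c≰x = refl
    ... | yes c≤x rewrite dec-true (c ≤? x) c≤x with x <? c + ℓ
    ...   | yes x<c+ℓ rewrite dec-true (x <? c + ℓ) x<c+ℓ
                            | dec-true (x <? c + suc ℓ) (<-≤-trans x<c+ℓ (+-monoʳ-≤ c (n≤1+n ℓ))) = refl
    ...   | no x≮c+ℓ rewrite dec-false (x <? c + ℓ) x≮c+ℓ
                           | dec-false (x <? c + suc ℓ) (x≮c+ℓ ∘ m<n+suc[o]∧m≢n+o⇒m<n+o c ℓ x≢c+ℓ) = refl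

    g0'-extend : ∀ s P x → x ≢ s + covered P + ℓ
               → g0' n T s (P ·⟨ j , ℓ ⟩) x ≡ g0' n T s (P ·⟨ j , suc ℓ ⟩) x
    g0'-extend s [] x x≢ rewrite +-identityʳ s = g0'-tgt-extend s x x≢
    g0'-extend s (chr ∷ P) x x≢ with does (x ≟ s)
    ... | true  = refl
    ... | false = g0'-extend (suc s) P x (x≢ ∘ λ e → trans e (cong (_+ ℓ) (sym (+-suc s (covered P)))))
    g0'-extend s (tgt t m ∷ P) x x≢ with does (s ≤? x) ∧ does (x <? s + m)
    ... | true  = refl
    ... | false = g0'-extend (s + m) P x (x≢ ∘ λ e → trans e (cong (_+ ℓ) (+-assoc s m (covered P))))

    g0'-tgt-end-char : ∀ c → IsChar (g0' n T c [ tgt j ℓ ] (c + ℓ))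
    g0'-tgt-end-char c rewrite dec-false (c + ℓ <? c + ℓ) (n≮n (c + ℓ)) | ∧-zeroʳ (does (c ≤? c + ℓ)) = tt

    g0'-tgt-end-ptr : ∀ c → ¬ IsChar (g0' n T c [ tgt j (suc ℓ) ] (c + ℓ))
    g0'-tgt-end-ptr c rewrite dec-true (c ≤? c + ℓ) (m≤m+n c ℓ)
                            | dec-true (c + ℓ <? c + suc ℓ) (+-monoʳ-< c (n<1+n ℓ)) = λ ()

Same-class∈F : ∀ (F : Family) {z} → Dom F z → Same F z ∈F F
Same-class∈F F {z} z∈F = z , z∈F , λ _ → mk⇔ id id

module D'Classes {A : Set} (n : ℕ) (T : ℕ → A) (P : PBP) (j ℓ : ℕ) where
  open SourcePaths n T (P ·⟨ j , ℓ ⟩)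

  D : Family
  D = D' n T P j ℓ

  D'-sym : ∀ {u v} → Same D u v → Same D v u
  D'-sym (u∈ , v∈ , s , a , b) = v∈ , u∈ , s , b , a

  D'-trans : ∀ {u v w} → Same D u v → Same D v w → Same D u w
  D'-trans {w = w} (u∈ , _ , s , a , b) (_ , w∈ , s₂ , b₂ , c) =
    u∈ , w∈ , s , a , subst (Source n T (P ·⟨ j , ℓ ⟩) w) (sym (Source-unique b b₂)) c

  Same-new-source : ∀ {x y} → InNew P ℓ x → Source n T (P ·⟨ j , ℓ ⟩) x y → Same D x y
  Same-new-source {x} {y} x∈ sy = inj₁ x∈ , inj₂ (x , x∈ , sy) , y , sy , Source-self sy

  Same-new-refl : ∀ {x y} → InNew P ℓ x → Source n T (P ·⟨ j , ℓ ⟩) x y → Same D x x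
  Same-new-refl {y = y} x∈ sy = inj₁ x∈ , inj₁ x∈ , y , sy , sy

source-class : ∀ {A : Set} (n : ℕ) (T : ℕ → A) (P : PBP) (j ℓ : ℕ)
  → ∀ x → InNew P ℓ x → ∀ y → Source n T (P ·⟨ j , ℓ ⟩) x y
  → ∃[ X ] (X ∈F D' n T P j ℓ × X x × X y)
source-class n T P j ℓ x x∈ y sy =
  Same D x , Same-class∈F D (inj₁ x∈) , Same-new-refl x∈ sy , Same-new-source x∈ sy
  where open D'Classes n T P j ℓ

module Extension {A : Set} (n : ℕ) (T : ℕ → A) (P : PBP) (j ℓ : ℕ) (s′ : ℕ)
  (p⇝s′ : Path (g0 n T (P ·⟨ j , suc ℓ ⟩)) (next P + ℓ) s′) where

  p : ℕ
  p = next P + ℓ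

  G G⁺ : ℕ → A ⊎ ℕ
  G  = g0 n T (P ·⟨ j , ℓ ⟩)
  G⁺ = g0 n T (P ·⟨ j , suc ℓ ⟩)

  G-p : IsChar (G p)
  G-p = subst IsChar (sym (g0'-++-beyond n T 1 P [ tgt j ℓ ] p (m≤m+n (next P) ℓ)))
                     (g0'-tgt-end-char n T j ℓ (next P))

  G⁺-p : ¬ IsChar (G⁺ p)
  G⁺-p = g0'-tgt-end-ptr n T j ℓ (next P)
       ∘ subst IsChar (g0'-++-beyond n T 1 P [ tgt j (suc ℓ) ] p (m≤m+n (next P) ℓ))

  open Redirect G G⁺ p (g0'-extend n T j ℓ 1 P) G-p G⁺-p
  open SourcePaths n T (P ·⟨ j , ℓ ⟩)
  module S⁺ = SourcePaths n T (P ·⟨ j , suc ℓ ⟩)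
  open D'Classes n T P j ℓ using (D; D'-sym; D'-trans)
  module C⁺ = D'Classes n T P j (suc ℓ)

  D⁺ Made Run : Family
  D⁺   = C⁺.D
  Made = applyOp (makeSet' s′) (applyOp (makeSet' p) D)
  Run  = applyOp (union p s′) Made

  ops : List Op
  ops = makeSet' p ∷ makeSet' s′ ∷ union p s′ ∷ []

  p∈new : InNew P (suc ℓ) p
  p∈new = m≤m+n (next P) ℓ , +-monoʳ-< (next P) (n<1+n ℓ)

  InNew-extend : ∀ {x} → InNew P ℓ x → InNew P (suc ℓ) x
  InNew-extend (i≤x , x<i+ℓ) = i≤x , <-≤-trans x<i+ℓ (+-monoʳ-≤ (next P) (n≤1+n ℓ))

  InNew-shrink : ∀ {x} → InNew P (suc ℓ) x → x ≢ p → InNew P ℓ x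
  InNew-shrink (i≤x , x<i+1+ℓ) x≢p = i≤x , m<n+suc[o]∧m≢n+o⇒m<n+o (next P) ℓ x≢p x<i+1+ℓ

  s′≢p : s′ ≢ p
  s′≢p refl = G⁺-p (Path-end p⇝s′)

  G-s′ : IsChar (G s′)
  G-s′ = subst IsChar (sym (g0'-extend n T j ℓ 1 P s′ s′≢p)) (Path-end p⇝s′)

  source⁺-p : Source n T (P ·⟨ j , suc ℓ ⟩) p s′
  source⁺-p = S⁺.Path⇒Source p⇝s′

  Dom-run⇒Dom⁺ : ∀ {u} → Dom Run u → Dom D⁺ u
  Dom-run⇒Dom⁺ (inj₁ (inj₁ (inj₁ u∈))) = inj₁ (InNew-extend u∈)
  Dom-run⇒Dom⁺ {u} (inj₁ (inj₁ (inj₂ (x , x∈ , sx)))) with u ≟ p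
  ... | yes refl = inj₁ p∈new
  ... | no u≢p   = inj₂ (x , InNew-extend x∈ , S⁺.Path⇒Source (Path-avoiding (Source⇒Path sx) u≢p))
  Dom-run⇒Dom⁺ (inj₁ (inj₂ refl)) = inj₁ p∈new
  Dom-run⇒Dom⁺ (inj₂ refl)        = inj₂ (p , p∈new , source⁺-p)

  Dom⁺⇒Dom-run : ∀ {u} → Dom D⁺ u → Dom Run u
  Dom⁺⇒Dom-run {u} (inj₁ u∈) with u ≟ p
  ... | yes refl = inj₁ (inj₂ refl)
  ... | no u≢p   = inj₁ (inj₁ (inj₁ (InNew-shrink u∈ u≢p)))
  Dom⁺⇒Dom-run {u} (inj₂ (x , x∈ , sx)) with x ≟ p
  ... | yes refl = inj₂ (Path-unique (S⁺.Source⇒Path sx) p⇝s′)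
  ... | no x≢p with Path-split (S⁺.Source⇒Path sx)
  ...   | inj₁ (x⇝u , _) = inj₁ (inj₁ (inj₂ (x , InNew-shrink x∈ x≢p , Path⇒Source x⇝u)))
  ...   | inj₂ (_ , p⇝u) = inj₂ (Path-unique p⇝u p⇝s′)

  Same⁺-p-s′ : Same D⁺ p s′
  Same⁺-p-s′ = C⁺.Same-new-source p∈new source⁺-p

  Same-made⇒Same⁺ : ∀ {u v} → Same Made u v → Same D⁺ u v
  Same-made⇒Same⁺ (inj₁ (inj₁ (u∈ , v∈ , s , a , b))) with s ≟ p
  ... | yes refl = Dom-run⇒Dom⁺ (inj₁ (inj₁ u∈)) , Dom-run⇒Dom⁺ (inj₁ (inj₁ v∈)) , s′
                 , S⁺.Path⇒Source (Path-via (Source⇒Path a) p⇝s′)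
                 , S⁺.Path⇒Source (Path-via (Source⇒Path b) p⇝s′)
  ... | no s≢p   = Dom-run⇒Dom⁺ (inj₁ (inj₁ u∈)) , Dom-run⇒Dom⁺ (inj₁ (inj₁ v∈)) , s
                 , S⁺.Path⇒Source (Path-avoiding (Source⇒Path a) s≢p)
                 , S⁺.Path⇒Source (Path-avoiding (Source⇒Path b) s≢p)
  Same-made⇒Same⁺ (inj₁ (inj₂ (refl , refl))) = inj₁ p∈new , inj₁ p∈new , s′ , source⁺-p , source⁺-p
  Same-made⇒Same⁺ (inj₂ (refl , refl)) = C⁺.D'-trans (C⁺.D'-sym Same⁺-p-s′) Same⁺-p-s′

  Same-run⇒Same⁺ : ∀ {u v} → Same Run u v → Same D⁺ u v
  Same-run⇒Same⁺ (inj₁ uv) = Same-made⇒Same⁺ uv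
  Same-run⇒Same⁺ (inj₂ (inj₁ (up , s′v))) =
    C⁺.D'-trans (Same-made⇒Same⁺ up) (C⁺.D'-trans Same⁺-p-s′ (Same-made⇒Same⁺ s′v))
  Same-run⇒Same⁺ (inj₂ (inj₂ (us′ , pv))) =
    C⁺.D'-trans (Same-made⇒Same⁺ us′) (C⁺.D'-trans (C⁺.D'-sym Same⁺-p-s′) (Same-made⇒Same⁺ pv))

  Same-made-sym : ∀ {u v} → Same Made u v → Same Made v u
  Same-made-sym (inj₁ (inj₁ uv))       = inj₁ (inj₁ (D'-sym uv))
  Same-made-sym (inj₁ (inj₂ (a , b)))  = inj₁ (inj₂ (b , a))
  Same-made-sym (inj₂ (a , b))         = inj₂ (b , a)

  Same-made-trans : ∀ {u v w} → Same Made u v → Same Made v w → Same Made u w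
  Same-made-trans uv (inj₁ (inj₂ (refl , refl)))             = uv
  Same-made-trans uv (inj₂ (refl , refl))                    = uv
  Same-made-trans (inj₁ (inj₁ uv)) (inj₁ (inj₁ vw))          = inj₁ (inj₁ (D'-trans uv vw))
  Same-made-trans (inj₁ (inj₂ (refl , refl))) vw@(inj₁ (inj₁ _)) = vw
  Same-made-trans (inj₂ (refl , refl)) vw@(inj₁ (inj₁ _))        = vw

  Dom-root : ∀ {u r} → Dom D u → Path G u r → Dom D r
  Dom-root {u} (inj₁ u∈new) u⇝r = inj₂ (u , u∈new , Path⇒Source u⇝r)
  Dom-root u∈@(inj₂ (_ , _ , sx)) u⇝r =
    subst (Dom D) (Path-unique (stop (Path-end (Source⇒Path sx))) u⇝r) u∈

  Same-root : ∀ {u r} → Dom D u → Path G u r → Same D u r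
  Same-root {r = r} u∈ u⇝r =
    u∈ , Dom-root u∈ u⇝r , r , Path⇒Source u⇝r , Path⇒Source (stop (Path-end u⇝r))

  Same-made-p⊎s′ : ∀ {u} → Dom D⁺ u → Path G⁺ u s′ → Same Made u p ⊎ Same Made u s′
  Same-made-p⊎s′ {u} u∈ u⇝s′ with Dom⁺⇒Dom-run u∈
  ... | inj₁ (inj₂ refl) = inj₁ (inj₁ (inj₂ (refl , refl)))
  ... | inj₂ refl        = inj₂ (inj₂ (refl , refl))
  ... | inj₁ (inj₁ u∈D) with Path-split u⇝s′
  ...   | inj₁ (u⇝s′₀ , _) = inj₂ (inj₁ (inj₁ (Same-root u∈D u⇝s′₀)))
  ...   | inj₂ (u⇝p , _)   = inj₁ (inj₁ (inj₁ (Same-root u∈D u⇝p)))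

  module _ {s} (s≢s′ : s ≢ s′) where

    source⁺-old : ∀ {w} → Source n T (P ·⟨ j , suc ℓ ⟩) w s → Path G w s × s ≢ p
    source⁺-old sw with Path-split (S⁺.Source⇒Path sw)
    ... | inj₁ r       = r
    ... | inj₂ (_ , r) = contradiction (Path-unique r p⇝s′) s≢s′

    Dom⁺⇒Dom : ∀ {w} → Dom D⁺ w → Path G w s → s ≢ p → Dom D w
    Dom⁺⇒Dom w∈ w⇝s s≢p with Dom⁺⇒Dom-run w∈
    ... | inj₁ (inj₁ w∈D)  = w∈D
    ... | inj₁ (inj₂ refl) = contradiction (Path-unique (stop G-p) w⇝s) (s≢p ∘ sym)
    ... | inj₂ refl        = contradiction (Path-unique (stop G-s′) w⇝s) (s≢s′ ∘ sym)

  Same⁺⇒Same-run : ∀ {u v} → Same D⁺ u v → Same Run u v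
  Same⁺⇒Same-run (u∈ , v∈ , s , a , b) with s ≟ s′
  ... | yes refl with Same-made-p⊎s′ u∈ (S⁺.Source⇒Path a) | Same-made-p⊎s′ v∈ (S⁺.Source⇒Path b)
  ...   | inj₁ up  | inj₁ vp  = inj₁ (Same-made-trans up (Same-made-sym vp))
  ...   | inj₁ up  | inj₂ vs′ = inj₂ (inj₁ (up , Same-made-sym vs′))
  ...   | inj₂ us′ | inj₁ vp  = inj₂ (inj₂ (us′ , Same-made-sym vp))
  ...   | inj₂ us′ | inj₂ vs′ = inj₁ (Same-made-trans us′ (Same-made-sym vs′))
  Same⁺⇒Same-run (u∈ , v∈ , s , a , b) | no s≢s′ =
    inj₁ (inj₁ (inj₁ (Dom⁺⇒Dom s≢s′ u∈ u⇝s s≢p , Dom⁺⇒Dom s≢s′ v∈ v⇝s s≢p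
                     , s , Path⇒Source u⇝s , Path⇒Source v⇝s)))
    where
      u⇝s = proj₁ (source⁺-old s≢s′ a)
      v⇝s = proj₁ (source⁺-old s≢s′ b)
      s≢p = proj₂ (source⁺-old s≢s′ a)

  D'-extend-by-ops : length ops ≤ 3 × Applicable D ops × run D ops ≈F D⁺
  D'-extend-by-ops = ≤-refl , ((inj₁ (inj₂ refl) , inj₂ refl) , tt)
                   , (λ _ → mk⇔ Dom-run⇒Dom⁺ Dom⁺⇒Dom-run) , (λ _ _ → mk⇔ Same-run⇒Same⁺ Same⁺⇒Same-run)

D'-extend : ∀ {A : Set} (n : ℕ) (T : ℕ → A) (P : PBP) (j ℓ : ℕ) → Valid n T (P ·⟨ j , suc ℓ ⟩)
  → ∃[ ops ] (length ops ≤ 3 × Applicable (D' n T P j ℓ) ops × run (D' n T P j ℓ) ops ≈F D' n T P j (suc ℓ))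
D'-extend n T P j ℓ ((covered≤n , _) , resolves) =
  let s′ , p⇝s′ = IsChar-g⇒∃Path n p (resolves p (s≤s z≤n) p≤n)
  in Extension.ops n T P j ℓ s′ p⇝s′ , Extension.D'-extend-by-ops n T P j ℓ s′ p⇝s′
  where
    open SourcePaths n T (P ·⟨ j , suc ℓ ⟩)
    p : ℕ
    p = next P + ℓ
    p≤n : p ≤ n
    p≤n = subst (_≤ n) (trans (covered-++ P (tgt j (suc ℓ))) (+-suc (covered P) ℓ)) covered≤n

corollary2 : (∀ {A : Set} (n : ℕ) (T : ℕ → A) (P : PBP) (j ℓ : ℕ)
    → Valid n T P → 1 ≤ j → j ≤ n → 1 ≤ ℓ → Valid n T (P ·⟨ j , ℓ ⟩)
    → ∀ x → InNew P ℓ x → ∀ y → Source n T (P ·⟨ j , ℓ ⟩) x y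
    → ∃[ X ] (X ∈F D' n T P j ℓ × X x × X y))
    × (∃[ c ] (∀ {A : Set} (n : ℕ) (T : ℕ → A) (P : PBP) (j ℓ : ℕ)
    → Valid n T P → 1 ≤ j → j ≤ n → 1 ≤ ℓ → Valid n T (P ·⟨ j , ℓ ⟩)
    → Valid n T (P ·⟨ j , suc ℓ ⟩)
    → ∃[ ops ] (length ops ≤ c × Applicable (D' n T P j ℓ) ops
    × run (D' n T P j ℓ) ops ≈F D' n T P j (suc ℓ))))
corollary2 = (λ n T P j ℓ _ _ _ _ _ → source-class n T P j ℓ)
           , 3 , (λ n T P j ℓ _ _ _ _ _ → D'-extend n T P j ℓ)
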